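{- Let $p\geq 3$ be a prime and $n\geq 3$ an integer. Then $$r_p(\mathbb{F}_p^n)\geq(p-1)^n+\frac{n-2}{2}(p-1)(p-2)^{n-3}.$$
   Context: For a prime $p$ and $n\in\mathbb{N}$, $r_p(\mathbb{F}_p^n)$ denotes the maximum cardinality of a subset of $\mathbb{F}_p^n$ containing no $p$-progression, i.e. no set $\{a+ib : i\in\{0,\dots,p-1\}\}$ with $a,b\in\mathbb{F}_p^n$, $b\neq0$; equivalently, containing no full affine line of $\mathbb{F}_p^n$. -}

module Defs where

open import Data.Nat using (ℕ; zero; suc; _+_; _*_)
open import Data.Nat.DivMod using (_mod_)
open import Data.Fin using (Fin; toℕ)
open import Data.Vec using (Vec; zipWith; lookup)
open import Data.Product using (∃; _×_)
open import Data.List using (List)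
open import Data.List.Membership.Propositional using (_∈_)
open import Relation.Binary.PropositionalEquality using (_≡_; _≢_)
open import Relation.Nullary using (¬_)

-- Arithmetic of ℤ/pℤ on Fin p (Fin 0 is empty, so the p = 0 case is vacuous).
_+ₚ_ : ∀ {p} → Fin p → Fin p → Fin p
_+ₚ_ {suc k} x y = (toℕ x + toℕ y) mod suc k

_*ₚ_ : ∀ {p} → Fin p → Fin p → Fin p
_*ₚ_ {suc k} x y = (toℕ x * toℕ y) mod suc k

linePt : ∀ {p n} → Vec (Fin p) n → Vec (Fin p) n → Fin p → Vec (Fin p) n
linePt a b i = zipWith (λ x y → x +ₚ (i *ₚ y)) a b

NonZeroVec : ∀ {p n} → Vec (Fin p) n → Set
NonZeroVec {n = n} b = ∃ λ (j : Fin n) → toℕ (lookup b j) ≢ 0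

ProgressionFree : ∀ {p n} → List (Vec (Fin p) n) → Set
ProgressionFree {p} {n} A =
  (a b : Vec (Fin p) n) → NonZeroVec b → ¬ ((i : Fin p) → linePt a b i ∈ A)

-- Write p = 2h + 1 and m = n − 2, and call 1, …, h the low and h + 1, …, 2h the high residues.
-- The set consists of the points (u, v, w) ∈ 𝔽_p² × 𝔽_pᵐ of five kinds (the constructors of
-- Admissible): u ≠ v both nonzero and w without 0; u = v low and w without 1, with at most one 0;
-- u = v high and w without 0 and 1; one of u, v zero, the other high, and w without 0 but with a 1.
-- Summing the five counts gives (p − 1)ⁿ + ((n − 2)/2)(p − 1)(p − 2)ⁿ⁻³.
--
-- A line in the set cannot move in a tail coordinate k: where wₖ = 0 the point is low-diagonal, so
-- the line crosses the diagonal there (were it parallel to it, it would be diagonal where wₖ = 1),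
-- and only there, so every other tail coordinate is constant and w contains a 1 only where wₖ = 1.
-- Where u = 0 the point lies on an axis, so v is high there; hence v is not constant (it takes the
-- low value u at the crossing), and symmetrically u is not; but then the points where u = 0 and
-- where v = 0 both have a 1 in w and coincide, which is absurd. If the tail is constant it contains
-- a 1 (u or v vanishes somewhere), so the line avoids the diagonal and is parallel to it; then the
-- high values of v where u = 0 and of u where v = 0 add up to 0 modulo p, while their sum lies in
-- (p, 2p).

module Submission where

open import Defs
open import Data.Nat using (ℕ; zero; suc; _+_; _*_; _∸_; _^_; _≤_; _<_; s≤s; z≤n)
open import Data.Nat.Properties hiding (suc-injective)
open import Data.Nat.DivMod using (_%_; _/_; _mod_; %-distribˡ-+; %-distribˡ-*; m%n%n≡m%n; [m+n]%n≡m%n;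
  [m+kn]%n≡m%n; m≤n⇒[n∸m]%m≡n%m; m<n⇒m%n≡m; m%n<n; m≡m%n+[m/n]*n)
open import Data.Nat.Divisibility using (_∣_; divides; n∣m⇒m%n≡0)
open import Data.Nat.Primality using (Prime; euclidsLemma; prime⇒¬composite; composite-≢)
open import Data.Nat.Tactic.RingSolver using (solve-∀)
open import Data.Fin using (Fin; zero; suc; toℕ; punchOut; punchIn; _↑ˡ_; _↑ʳ_)
open import Data.Fin.Properties using (toℕ-fromℕ<; toℕ-injective; toℕ<n; any?; punchOut-injective; injective⇒≤;
  suc-injective; toℕ-↑ˡ; toℕ-↑ʳ; ↑ˡ-injective; ↑ʳ-injective; punchIn-injective; punchInᵢ≢i)
  renaming (_≟_ to _≟ᶠ_)
open import Data.Vec using (Vec; []; _∷_; lookup)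
open import Data.Vec.Properties using (∷-injective; lookup-zipWith)
open import Data.List using (List; []; _∷_; [_]; map; _++_; length; tabulate)
open import Data.List.Properties using (length-map; length-++; length-tabulate)
open import Data.List.Membership.Propositional using (_∈_)
open import Data.List.Membership.Propositional.Properties using (∈-++⁻; ∈-map⁻; ∈-tabulate⁻)
open import Data.List.Relation.Unary.Any.Properties using (singleton⁻)
open import Data.List.Relation.Unary.Any using (here; there)
open import Data.List.Relation.Unary.All as All using ()
open import Data.List.Relation.Unary.AllPairs using ([]; _∷_)
open import Data.List.Relation.Unary.Unique.Propositional using (Unique)
open import Data.List.Relation.Unary.Unique.Propositional.Properties using (++⁺; map⁺; tabulate⁺)
open import Data.List.Relation.Binary.Disjoint.Propositional using (Disjoint)
open import Data.Product using (Σ-syntax; _×_; _,_; proj₁; proj₂; ∃)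
open import Data.Sum using (_⊎_; inj₁; inj₂)
open import Data.Empty using (⊥; ⊥-elim)
open import Function.Definitions using (Injective)
open import Function.Base using (_∘_)
open import Relation.Nullary using (¬_; yes; no)
open import Relation.Nullary.Decidable using (¬?; decidable-stable)
open import Relation.Binary.PropositionalEquality hiding ([_])
open import Relation.Binary.Structures using (IsEquivalence)
open import Relation.Binary.Bundles using (Setoid)
import Relation.Binary.Reasoning.Setoid as SetoidReasoning
open import Level using (0ℓ)

module _ {A : Set} where

  consProduct : ∀ {k} → List A → (A → List (Vec A k)) → List (Vec A (suc k))
  consProduct []       f = []
  consProduct (x ∷ xs) f = map (x ∷_) (f x) ++ consProduct xs f

  ∈-consProduct⁻ : ∀ {k} {y : A} {ys : Vec A k} xs f →
    y ∷ ys ∈ consProduct xs f → y ∈ xs × ys ∈ f y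
  ∈-consProduct⁻ (x ∷ xs) f y∈ with ∈-++⁻ (map (x ∷_) (f x)) y∈
  ... | inj₂ y∈rest = let y∈xs , ys∈ = ∈-consProduct⁻ xs f y∈rest in there y∈xs , ys∈
  ... | inj₁ y∈head with ∈-map⁻ (x ∷_) y∈head
  ...   | _ , ys∈ , eq with ∷-injective eq
  ...     | refl , refl = here refl , ys∈

  consProduct-disjoint : ∀ {k} {xs xs' : List A} {f f' : A → List (Vec A k)} →
    Disjoint xs xs' → Disjoint (consProduct xs f) (consProduct xs' f')
  consProduct-disjoint {xs = xs} {xs'} {f} {f'} xs#xs' {_ ∷ _} (∈₁ , ∈₂) =
    xs#xs' (proj₁ (∈-consProduct⁻ xs f ∈₁) , proj₁ (∈-consProduct⁻ xs' f' ∈₂))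

  consProduct⁺ : ∀ {k} {xs : List A} {f : A → List (Vec A k)} →
    Unique xs → (∀ x → Unique (f x)) → Unique (consProduct xs f)
  consProduct⁺ {xs = []}     []           uf = []
  consProduct⁺ {xs = x ∷ xs} {f} (x∉ ∷ u) uf =
    ++⁺ (map⁺ (λ eq → proj₂ (∷-injective eq)) (uf x)) (consProduct⁺ u uf) head#rest
    where
    head#rest : Disjoint (map (x ∷_) (f x)) (consProduct xs f)
    head#rest {_ ∷ _} (∈₁ , ∈₂) with ∈-map⁻ (x ∷_) ∈₁
    ... | _ , _ , eq with ∷-injective eq
    ... | refl , refl = All.lookup x∉ (proj₁ (∈-consProduct⁻ xs f ∈₂)) refl

  length-consProduct : ∀ {k} xs (f : A → List (Vec A k)) {c} →
    (∀ {x} → x ∈ xs → length (f x) ≡ c) → length (consProduct xs f) ≡ length xs * c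
  length-consProduct []       f     eq = refl
  length-consProduct (x ∷ xs) f {c} eq = begin
    length (map (x ∷_) (f x) ++ consProduct xs f)           ≡⟨ length-++ (map (x ∷_) (f x)) ⟩
    length (map (x ∷_) (f x)) + length (consProduct xs f)   ≡⟨ cong₂ _+_ (trans (length-map (x ∷_) (f x)) (eq (here refl)))
                                                                          (length-consProduct xs f (λ x∈ → eq (there x∈))) ⟩
    c + length xs * c                                        ∎
    where open ≡-Reasoning

disjoint-++⁺ʳ : ∀ {A : Set} {xs ys zs : List A} → Disjoint xs ys → Disjoint xs zs → Disjoint xs (ys ++ zs)
disjoint-++⁺ʳ {ys = ys} xs#ys xs#zs (v∈xs , v∈ys++zs) with ∈-++⁻ ys v∈ys++zs
... | inj₁ v∈ys = xs#ys (v∈xs , v∈ys)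
... | inj₂ v∈zs = xs#zs (v∈xs , v∈zs)

injective⇒surjective : ∀ {n} (f : Fin n → Fin n) → Injective _≡_ _≡_ f → ∀ y → ∃ λ x → f x ≡ y
injective⇒surjective {suc n} f f-inj y with any? (λ x → f x ≟ᶠ y)
... | yes hit = hit
... | no miss = ⊥-elim (1+n≰n (injective⇒≤ {f = squeeze} squeeze-inj))
  where
  squeeze : Fin (suc n) → Fin n
  squeeze x = punchOut {i = y} {j = f x} (λ eq → miss (x , sym eq))
  squeeze-inj : Injective _≡_ _≡_ squeeze
  squeeze-inj {x} {x'} eq =
    f-inj (punchOut-injective (λ e → miss (x , sym e)) (λ e → miss (x' , sym e)) eq)

-- Arithmetic modulo P

module Modular (Q : ℕ) where

  P : ℕ
  P = suc Q

  infix 4 _≡ₘ_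
  record _≡ₘ_ (x y : ℕ) : Set where
    constructor mod-eq
    field %-eq : x % P ≡ y % P
  open _≡ₘ_

  ≡ₘ-sym : ∀ {x y} → x ≡ₘ y → y ≡ₘ x
  ≡ₘ-sym (mod-eq x≡y) = mod-eq (sym x≡y)

  ≡ₘ-isEquivalence : IsEquivalence _≡ₘ_
  ≡ₘ-isEquivalence = record
    { refl  = mod-eq refl
    ; sym   = ≡ₘ-sym
    ; trans = λ x≡y y≡z → mod-eq (trans (%-eq x≡y) (%-eq y≡z))
    }

  ≡ₘ-setoid : Setoid 0ℓ 0ℓ
  ≡ₘ-setoid = record { isEquivalence = ≡ₘ-isEquivalence }

  module ≡ₘ-Reasoning = SetoidReasoning ≡ₘ-setoid

  %-≡ₘ : ∀ x → x % P ≡ₘ x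
  %-≡ₘ x = mod-eq (m%n%n≡m%n x P)

  +P-≡ₘ : ∀ x → x + P ≡ₘ x
  +P-≡ₘ x = mod-eq ([m+n]%n≡m%n x P)

  +-multiple-≡ₘ : ∀ x k → x + k * P ≡ₘ x
  +-multiple-≡ₘ x k = mod-eq ([m+kn]%n≡m%n x k P)

  +-congₘ : ∀ {x x' y y'} → x ≡ₘ x' → y ≡ₘ y' → x + y ≡ₘ x' + y'
  +-congₘ {x} {x'} {y} {y'} (mod-eq x≡x') (mod-eq y≡y') = mod-eq (begin
    (x + y) % P              ≡⟨ %-distribˡ-+ x y P ⟩
    (x % P + y % P) % P      ≡⟨ cong₂ (λ u v → (u + v) % P) x≡x' y≡y' ⟩
    (x' % P + y' % P) % P    ≡⟨ %-distribˡ-+ x' y' P ⟨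
    (x' + y') % P            ∎)
    where open ≡-Reasoning

  *-congₘ : ∀ {x x' y y'} → x ≡ₘ x' → y ≡ₘ y' → x * y ≡ₘ x' * y'
  *-congₘ {x} {x'} {y} {y'} (mod-eq x≡x') (mod-eq y≡y') = mod-eq (begin
    (x * y) % P              ≡⟨ %-distribˡ-* x y P ⟩
    (x % P * (y % P)) % P    ≡⟨ cong₂ (λ u v → (u * v) % P) x≡x' y≡y' ⟩
    (x' % P * (y' % P)) % P  ≡⟨ %-distribˡ-* x' y' P ⟨
    (x' * y') % P            ∎)
    where open ≡-Reasoning

  +-congˡₘ : ∀ x {y y'} → y ≡ₘ y' → x + y ≡ₘ x + y'
  +-congˡₘ x = +-congₘ {x} {x} (mod-eq refl)

  *-congˡₘ : ∀ x {y y'} → y ≡ₘ y' → x * y ≡ₘ x * y'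
  *-congˡₘ x = *-congₘ {x} {x} (mod-eq refl)

  ≡ₘ⇒∣∸ : ∀ {x y} → x ≡ₘ y → x ≤ y → P ∣ y ∸ x
  ≡ₘ⇒∣∸ {x} {y} (mod-eq x≡y) x≤y = divides (y / P ∸ x / P) (begin
    y ∸ x                                           ≡⟨ cong₂ _∸_ (m≡m%n+[m/n]*n y P) (m≡m%n+[m/n]*n x P) ⟩
    (y % P + y / P * P) ∸ (x % P + x / P * P)       ≡⟨ cong (λ r → (y % P + y / P * P) ∸ (r + x / P * P)) x≡y ⟩
    (y % P + y / P * P) ∸ (y % P + x / P * P)       ≡⟨ [m+n]∸[m+o]≡n∸o (y % P) _ _ ⟩
    y / P * P ∸ x / P * P                           ≡⟨ *-distribʳ-∸ P (y / P) (x / P) ⟨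
    (y / P ∸ x / P) * P                             ∎)
    where open ≡-Reasoning

  ∣-<P⇒≡0 : ∀ {d} → P ∣ d → d < P → d ≡ 0
  ∣-<P⇒≡0 {d} P∣d d<P = trans (sym (m<n⇒m%n≡m d<P)) (n∣m⇒m%n≡0 d P P∣d)

  +-cancelₘ-<P : ∀ x {y} → x + y ≡ₘ x → y < P → y ≡ 0
  +-cancelₘ-<P x {y} x+y≡x y<P =
    ∣-<P⇒≡0 (subst (P ∣_) (m+n∸m≡n x y) (≡ₘ⇒∣∸ (≡ₘ-sym x+y≡x) (m≤m+n x y))) y<P

  affine-cancelₘ-≤ : Prime P → ∀ {a b i j} → ¬ (P ∣ b) → a + i * b ≡ₘ a + j * b →
                     i ≤ j → j < P → i ≡ j
  affine-cancelₘ-≤ P-prime {a} {b} {i} {j} P∤b eq i≤j j<P with euclidsLemma (j ∸ i) b P-prime P∣[j∸i]b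
    where
    P∣[j∸i]b : P ∣ (j ∸ i) * b
    P∣[j∸i]b = subst (P ∣_) (trans ([m+n]∸[m+o]≡n∸o a (j * b) (i * b)) (sym (*-distribʳ-∸ b j i)))
                     (≡ₘ⇒∣∸ eq (+-monoʳ-≤ a (*-monoˡ-≤ b i≤j)))
  ... | inj₂ P∣b   = ⊥-elim (P∤b P∣b)
  ... | inj₁ P∣j∸i = ≤-antisym i≤j (m∸n≡0⇒m≤n (∣-<P⇒≡0 P∣j∸i (≤-<-trans (m∸n≤m j i) j<P)))

  affine-cancelₘ : Prime P → ∀ {a b i j} → ¬ (P ∣ b) → a + i * b ≡ₘ a + j * b →
                   i < P → j < P → i ≡ j
  affine-cancelₘ P-prime {i = i} {j} P∤b eq i<P j<P with ≤-total i j
  ... | inj₁ i≤j = affine-cancelₘ-≤ P-prime P∤b eq i≤j j<P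
  ... | inj₂ j≤i = sym (affine-cancelₘ-≤ P-prime P∤b (≡ₘ-sym eq) j≤i i<P)

  F : Set
  F = Fin P

  toℕ-mod : ∀ x → toℕ (x mod P) ≡ x % P
  toℕ-mod x = toℕ-fromℕ< (m%n<n x P)

  toℕ-≡ₘ⇒≡ : ∀ {x y : F} → toℕ x ≡ₘ toℕ y → x ≡ y
  toℕ-≡ₘ⇒≡ {x} {y} (mod-eq eq) =
    toℕ-injective (trans (sym (m<n⇒m%n≡m (toℕ<n x))) (trans eq (m<n⇒m%n≡m (toℕ<n y))))

  toℕ-mod-≡ₘ : ∀ x → toℕ (x mod P) ≡ₘ x
  toℕ-mod-≡ₘ x = mod-eq (trans (cong (_% P) (toℕ-mod x)) (m%n%n≡m%n x P))

  +ₚ-≡ₘ : ∀ (x y : F) → toℕ (x +ₚ y) ≡ₘ toℕ x + toℕ y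
  +ₚ-≡ₘ x y = toℕ-mod-≡ₘ (toℕ x + toℕ y)

  *ₚ-≡ₘ : ∀ (x y : F) → toℕ (x *ₚ y) ≡ₘ toℕ x * toℕ y
  *ₚ-≡ₘ x y = toℕ-mod-≡ₘ (toℕ x * toℕ y)

  -- Truncated subtraction is harmless here since toℕ y < P.
  _-ₚ_ : F → F → F
  x -ₚ y = (toℕ x + (P ∸ toℕ y)) mod P

  -ₚ-≡ₘ : ∀ (x y : F) → toℕ (x -ₚ y) ≡ₘ toℕ x + (P ∸ toℕ y)
  -ₚ-≡ₘ x y = toℕ-mod-≡ₘ (toℕ x + (P ∸ toℕ y))

  +ₚ-identityˡ : ∀ (x : F) → zero +ₚ x ≡ x
  +ₚ-identityˡ x = toℕ-≡ₘ⇒≡ (+ₚ-≡ₘ zero x)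

  +ₚ-identityʳ : ∀ (x : F) → x +ₚ zero ≡ x
  +ₚ-identityʳ x = toℕ-≡ₘ⇒≡ (begin
    toℕ (x +ₚ zero)   ≈⟨ +ₚ-≡ₘ x zero ⟩
    toℕ x + 0         ≡⟨ +-identityʳ (toℕ x) ⟩
    toℕ x             ∎)
    where open ≡ₘ-Reasoning

  +ₚ-cancel⇒zero : ∀ (x y : F) → x +ₚ y ≡ x → y ≡ zero
  +ₚ-cancel⇒zero x y eq = toℕ-injective (+-cancelₘ-<P (toℕ x) (begin
    toℕ x + toℕ y     ≈⟨ +ₚ-≡ₘ x y ⟨
    toℕ (x +ₚ y)      ≡⟨ cong toℕ eq ⟩
    toℕ x             ∎) (toℕ<n y))
    where open ≡ₘ-Reasoning

  y+ₚ[x-ₚy]≡x : ∀ (x y : F) → y +ₚ (x -ₚ y) ≡ x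
  y+ₚ[x-ₚy]≡x x y = toℕ-≡ₘ⇒≡ (begin
    toℕ (y +ₚ (x -ₚ y))     ≈⟨ +ₚ-≡ₘ y (x -ₚ y) ⟩
    Y + toℕ (x -ₚ y)        ≈⟨ +-congˡₘ Y (-ₚ-≡ₘ x y) ⟩
    Y + (X + (P ∸ Y))       ≡⟨ swap Y X (P ∸ Y) ⟩
    X + (Y + (P ∸ Y))       ≡⟨ cong (X +_) (m+[n∸m]≡n (<⇒≤ (toℕ<n y))) ⟩
    X + P                   ≈⟨ +P-≡ₘ X ⟩
    X                       ∎)
    where
    open ≡ₘ-Reasoning
    X Y : ℕ
    X = toℕ x
    Y = toℕ y
    swap : ∀ a b c → a + (b + c) ≡ b + (a + c)
    swap = solve-∀

  -ₚ≡zero⇒≡ : ∀ (x y : F) → x -ₚ y ≡ zero → x ≡ y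
  -ₚ≡zero⇒≡ x y eq = begin
    x                  ≡⟨ y+ₚ[x-ₚy]≡x x y ⟨
    y +ₚ (x -ₚ y)      ≡⟨ cong (y +ₚ_) eq ⟩
    y +ₚ zero          ≡⟨ +ₚ-identityʳ y ⟩
    y                  ∎
    where open ≡-Reasoning

  x-ₚx≡zero : ∀ (x : F) → x -ₚ x ≡ zero
  x-ₚx≡zero x = +ₚ-cancel⇒zero x (x -ₚ x) (y+ₚ[x-ₚy]≡x x x)

  -- Lines

  line : F → F → F → F
  line a b i = a +ₚ (i *ₚ b)

  line-≡ₘ : ∀ a b i → toℕ (line a b i) ≡ₘ toℕ a + toℕ i * toℕ b
  line-≡ₘ a b i = begin
    toℕ (a +ₚ (i *ₚ b))        ≈⟨ +ₚ-≡ₘ a (i *ₚ b) ⟩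
    toℕ a + toℕ (i *ₚ b)       ≈⟨ +-congˡₘ (toℕ a) (*ₚ-≡ₘ i b) ⟩
    toℕ a + toℕ i * toℕ b      ∎
    where open ≡ₘ-Reasoning

  line-constant : ∀ a {b} → b ≡ zero → ∀ i → line a b i ≡ a
  line-constant a refl i = toℕ-≡ₘ⇒≡ (begin
    toℕ (line a zero i)        ≈⟨ line-≡ₘ a zero i ⟩
    toℕ a + toℕ i * 0          ≡⟨ cong (toℕ a +_) (*-zeroʳ (toℕ i)) ⟩
    toℕ a + 0                  ≡⟨ +-identityʳ (toℕ a) ⟩
    toℕ a                      ∎)
    where open ≡ₘ-Reasoning

  line-difference : ∀ a₁ b₁ a₂ b₂ i →
    line a₂ b₂ i +ₚ line (a₁ -ₚ a₂) (b₁ -ₚ b₂) i ≡ line a₁ b₁ i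
  line-difference a₁ b₁ a₂ b₂ i = toℕ-≡ₘ⇒≡ (begin
    toℕ (line a₂ b₂ i +ₚ line (a₁ -ₚ a₂) (b₁ -ₚ b₂) i)
      ≈⟨ +ₚ-≡ₘ (line a₂ b₂ i) (line (a₁ -ₚ a₂) (b₁ -ₚ b₂) i) ⟩
    toℕ (line a₂ b₂ i) + toℕ (line (a₁ -ₚ a₂) (b₁ -ₚ b₂) i)
      ≈⟨ +-congₘ (line-≡ₘ a₂ b₂ i) (line-≡ₘ (a₁ -ₚ a₂) (b₁ -ₚ b₂) i) ⟩
    (A₂ + I * B₂) + (toℕ (a₁ -ₚ a₂) + I * toℕ (b₁ -ₚ b₂))
      ≈⟨ +-congˡₘ (A₂ + I * B₂) (+-congₘ (-ₚ-≡ₘ a₁ a₂) (*-congˡₘ I (-ₚ-≡ₘ b₁ b₂))) ⟩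
    (A₂ + I * B₂) + ((A₁ + (P ∸ A₂)) + I * (B₁ + (P ∸ B₂)))
      ≡⟨ regroup A₁ A₂ B₁ B₂ I (P ∸ A₂) (P ∸ B₂) ⟩
    (A₁ + I * B₁) + ((A₂ + (P ∸ A₂)) + I * (B₂ + (P ∸ B₂)))
      ≡⟨ cong₂ (λ u v → (A₁ + I * B₁) + (u + I * v))
               (m+[n∸m]≡n (<⇒≤ (toℕ<n a₂))) (m+[n∸m]≡n (<⇒≤ (toℕ<n b₂))) ⟩
    (A₁ + I * B₁) + suc I * P
      ≈⟨ +-multiple-≡ₘ (A₁ + I * B₁) (suc I) ⟩
    A₁ + I * B₁
      ≈⟨ line-≡ₘ a₁ b₁ i ⟨
    toℕ (line a₁ b₁ i) ∎)
    where
    open ≡ₘ-Reasoning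
    A₁ B₁ A₂ B₂ I : ℕ
    A₁ = toℕ a₁
    B₁ = toℕ b₁
    A₂ = toℕ a₂
    B₂ = toℕ b₂
    I = toℕ i
    regroup : ∀ a₁ a₂ b₁ b₂ i a₂' b₂' →
      (a₂ + i * b₂) + ((a₁ + a₂') + i * (b₁ + b₂')) ≡ (a₁ + i * b₁) + ((a₂ + a₂') + i * (b₂ + b₂'))
    regroup = solve-∀

  line-injective : Prime P → ∀ a {b} → b ≢ zero → Injective _≡_ _≡_ (line a b)
  line-injective P-prime a {b} b≢0 {i} {j} eq =
    toℕ-injective (affine-cancelₘ P-prime P∤b (begin
      toℕ a + toℕ i * toℕ b   ≈⟨ line-≡ₘ a b i ⟨
      toℕ (line a b i)        ≡⟨ cong toℕ eq ⟩
      toℕ (line a b j)        ≈⟨ line-≡ₘ a b j ⟩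
      toℕ a + toℕ j * toℕ b   ∎) (toℕ<n i) (toℕ<n j))
    where
    open ≡ₘ-Reasoning
    P∤b : ¬ (P ∣ toℕ b)
    P∤b P∣b = b≢0 (toℕ-injective (∣-<P⇒≡0 P∣b (toℕ<n b)))

  line-surjective : Prime P → ∀ a {b} → b ≢ zero → ∀ y → ∃ λ i → line a b i ≡ y
  line-surjective P-prime a b≢0 = injective⇒surjective (line a _) (line-injective P-prime a b≢0)

  lookup-linePt : ∀ {m} (a b : Vec F m) i k → lookup (linePt a b i) k ≡ line (lookup a k) (lookup b k) i
  lookup-linePt a b i k = lookup-zipWith (λ x y → x +ₚ (i *ₚ y)) k a b

  module TwoLines (a₁ b₁ a₂ b₂ : F) where

    Meet : F → Set
    Meet i = line a₁ b₁ i ≡ line a₂ b₂ i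

    difference : F → F
    difference = line (a₁ -ₚ a₂) (b₁ -ₚ b₂)

    meet⇒difference≡zero : ∀ i → Meet i → difference i ≡ zero
    meet⇒difference≡zero i eq =
      +ₚ-cancel⇒zero (line a₂ b₂ i) (difference i) (trans (line-difference a₁ b₁ a₂ b₂ i) eq)

    difference≡zero⇒meet : ∀ i → difference i ≡ zero → Meet i
    difference≡zero⇒meet i eq = begin
      line a₁ b₁ i                        ≡⟨ line-difference a₁ b₁ a₂ b₂ i ⟨
      line a₂ b₂ i +ₚ difference i        ≡⟨ cong (line a₂ b₂ i +ₚ_) eq ⟩
      line a₂ b₂ i +ₚ zero                ≡⟨ +ₚ-identityʳ (line a₂ b₂ i) ⟩
      line a₂ b₂ i                        ∎
      where open ≡-Reasoning

    parallel⇒difference-constant : b₁ ≡ b₂ → ∀ i → difference i ≡ a₁ -ₚ a₂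
    parallel⇒difference-constant refl = line-constant (a₁ -ₚ a₂) (x-ₚx≡zero b₁)

    parallel-meet⇒meet-everywhere : b₁ ≡ b₂ → ∀ {i} → Meet i → ∀ j → Meet j
    parallel-meet⇒meet-everywhere b₁≡b₂ {i} meet j = difference≡zero⇒meet j (begin
      difference j     ≡⟨ parallel⇒difference-constant b₁≡b₂ j ⟩
      a₁ -ₚ a₂         ≡⟨ parallel⇒difference-constant b₁≡b₂ i ⟨
      difference i     ≡⟨ meet⇒difference≡zero i meet ⟩
      zero             ∎)
      where open ≡-Reasoning

    -- The difference of the two lines is a constant c, so the right summand is c and the left one −c.
    parallel-zeros : b₁ ≡ b₂ → ∀ {t₁ t₂} → line a₁ b₁ t₁ ≡ zero → line a₂ b₂ t₂ ≡ zero →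
                     line a₂ b₂ t₁ +ₚ line a₁ b₁ t₂ ≡ zero
    parallel-zeros b₁≡b₂ {t₁} {t₂} zero₁ zero₂ = begin
      line a₂ b₂ t₁ +ₚ line a₁ b₁ t₂     ≡⟨ cong (line a₂ b₂ t₁ +ₚ_) first-at-t₂ ⟩
      line a₂ b₂ t₁ +ₚ (a₁ -ₚ a₂)        ≡⟨ cong (line a₂ b₂ t₁ +ₚ_) (parallel⇒difference-constant b₁≡b₂ t₁) ⟨
      line a₂ b₂ t₁ +ₚ difference t₁     ≡⟨ line-difference a₁ b₁ a₂ b₂ t₁ ⟩
      line a₁ b₁ t₁                      ≡⟨ zero₁ ⟩
      zero                               ∎
      where
      open ≡-Reasoning
      first-at-t₂ : line a₁ b₁ t₂ ≡ a₁ -ₚ a₂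
      first-at-t₂ = begin
        line a₁ b₁ t₂                    ≡⟨ line-difference a₁ b₁ a₂ b₂ t₂ ⟨
        line a₂ b₂ t₂ +ₚ difference t₂   ≡⟨ cong₂ _+ₚ_ zero₂ (parallel⇒difference-constant b₁≡b₂ t₂) ⟩
        zero +ₚ (a₁ -ₚ a₂)               ≡⟨ +ₚ-identityˡ (a₁ -ₚ a₂) ⟩
        a₁ -ₚ a₂                         ∎

    crossing-meet : Prime P → b₁ ≢ b₂ → ∃ Meet
    crossing-meet P-prime b₁≢b₂ with line-surjective P-prime (a₁ -ₚ a₂) (b₁≢b₂ ∘ -ₚ≡zero⇒≡ b₁ b₂) zero
    ... | i , δi≡0 = i , difference≡zero⇒meet i δi≡0

    crossing-meet-unique : Prime P → b₁ ≢ b₂ → ∀ {i j} → Meet i → Meet j → i ≡ j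
    crossing-meet-unique P-prime b₁≢b₂ {i} {j} meetᵢ meetⱼ =
      line-injective P-prime (a₁ -ₚ a₂) (b₁≢b₂ ∘ -ₚ≡zero⇒≡ b₁ b₂)
        (trans (meet⇒difference≡zero i meetᵢ) (sym (meet⇒difference≡zero j meetⱼ)))

-- The construction

module Construction (g : ℕ) where

  -- p = 2h + 1 and s = p − 2.
  h : ℕ
  h = suc g

  open Modular (h + h) public

  s : ℕ
  s = g + h

  one : F
  one = suc zero

  Low High : F → Set
  Low u = 1 ≤ toℕ u × toℕ u ≤ h
  High u = h < toℕ u

  Low⇒≢zero : ∀ {x} → Low x → x ≢ zero
  Low⇒≢zero (() , _) refl

  High⇒≢zero : ∀ {x} → High x → x ≢ zero
  High⇒≢zero () refl

  Low⇒¬High : ∀ {x} → Low x → ¬ High x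
  Low⇒¬High (_ , x≤h) h<x = <⇒≱ h<x x≤h

  NoZero NoOne HasZero HasOne AtMostOneZero : ∀ {m} → Vec F m → Set
  NoZero w = ∀ k → lookup w k ≢ zero
  NoOne w = ∀ k → lookup w k ≢ one
  HasZero w = ∃ λ k → lookup w k ≡ zero
  HasOne w = ∃ λ k → lookup w k ≡ one
  AtMostOneZero w = ∀ k k' → lookup w k ≡ zero → lookup w k' ≡ zero → k ≡ k'

  data Admissible {m} : Vec F (2 + m) → Set where
    offDiagonal  : ∀ {u v w} → u ≢ zero → v ≢ zero → u ≢ v → NoZero w → Admissible (u ∷ v ∷ w)
    lowDiagonal  : ∀ {u w} → Low u → NoOne w → AtMostOneZero w → Admissible (u ∷ u ∷ w)
    highDiagonal : ∀ {u w} → High u → NoZero w → NoOne w → Admissible (u ∷ u ∷ w)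
    firstAxis    : ∀ {v w} → High v → NoZero w → HasOne w → Admissible (zero ∷ v ∷ w)
    secondAxis   : ∀ {u w} → High u → NoZero w → HasOne w → Admissible (u ∷ zero ∷ w)

  nonZero nonZeroOne lowHalf highHalf : List F
  nonZero    = tabulate suc
  nonZeroOne = tabulate (λ (i : Fin s) → suc (suc i))
  lowHalf    = tabulate (λ (i : Fin h) → suc (i ↑ˡ h))
  highHalf   = tabulate (λ (i : Fin h) → suc (h ↑ʳ i))

  nonZeroExcept : Fin (h + h) → List F
  nonZeroExcept u = tabulate (λ (j : Fin s) → suc (punchIn u j))

  ∈-nonZero⁻ : ∀ {x} → x ∈ nonZero → x ≢ zero
  ∈-nonZero⁻ x∈ with ∈-tabulate⁻ {f = suc} x∈
  ... | _ , refl = λ ()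

  ∈-nonZeroOne⁻ : ∀ {x} → x ∈ nonZeroOne → x ≢ zero × x ≢ one
  ∈-nonZeroOne⁻ x∈ with ∈-tabulate⁻ {f = λ (i : Fin s) → suc (suc i)} x∈
  ... | _ , refl = (λ ()) , (λ ())

  ∈-lowHalf⁻ : ∀ {x} → x ∈ lowHalf → Low x
  ∈-lowHalf⁻ x∈ with ∈-tabulate⁻ {f = λ (i : Fin h) → suc (i ↑ˡ h)} x∈
  ... | i , refl = s≤s z≤n , ≤-trans (s≤s (≤-reflexive (toℕ-↑ˡ i h))) (toℕ<n i)

  ∈-highHalf⁻ : ∀ {x} → x ∈ highHalf → High x
  ∈-highHalf⁻ x∈ with ∈-tabulate⁻ {f = λ (i : Fin h) → suc (h ↑ʳ i)} x∈
  ... | i , refl = s≤s (subst (h ≤_) (sym (toℕ-↑ʳ h i)) (m≤m+n h (toℕ i)))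

  ∈-nonZeroExcept⁻ : ∀ {u x} → x ∈ nonZeroExcept u → x ≢ zero × x ≢ suc u
  ∈-nonZeroExcept⁻ {u} x∈ with ∈-tabulate⁻ {f = λ (j : Fin s) → suc (punchIn u j)} x∈
  ... | j , refl = (λ ()) , (λ eq → punchInᵢ≢i u j (suc-injective eq))

  nonZero-unique : Unique nonZero
  nonZero-unique = tabulate⁺ suc-injective

  nonZeroOne-unique : Unique nonZeroOne
  nonZeroOne-unique = tabulate⁺ (λ eq → suc-injective (suc-injective eq))

  lowHalf-unique : Unique lowHalf
  lowHalf-unique = tabulate⁺ (λ eq → ↑ˡ-injective h _ _ (suc-injective eq))

  highHalf-unique : Unique highHalf
  highHalf-unique = tabulate⁺ (λ eq → ↑ʳ-injective h _ _ (suc-injective eq))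

  nonZeroExcept-unique : ∀ u → Unique (nonZeroExcept u)
  nonZeroExcept-unique u = tabulate⁺ (λ eq → punchIn-injective u _ _ (suc-injective eq))

  infixr 6 _⊛_
  _⊛_ : ∀ {m} → List F → List (Vec F m) → List (Vec F (suc m))
  xs ⊛ ws = consProduct xs (λ _ → ws)

  vectorsOver : List F → (m : ℕ) → List (Vec F m)
  vectorsOver L zero    = [ [] ]
  vectorsOver L (suc m) = L ⊛ vectorsOver L m

  singleZeroNoOne : (m : ℕ) → List (Vec F m)
  singleZeroNoOne zero    = []
  singleZeroNoOne (suc m) = [ zero ] ⊛ vectorsOver nonZeroOne m ++ nonZeroOne ⊛ singleZeroNoOne m

  noZeroSomeOne : (m : ℕ) → List (Vec F m)
  noZeroSomeOne zero    = []
  noZeroSomeOne (suc m) = [ one ] ⊛ vectorsOver nonZero m ++ nonZeroOne ⊛ noZeroSomeOne m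

  noOneAtMostOneZero : (m : ℕ) → List (Vec F m)
  noOneAtMostOneZero m = vectorsOver nonZeroOne m ++ singleZeroNoOne m

  lowFibre highFibre : (m : ℕ) → F → List (Vec F (suc m))
  lowFibre m zero    = []
  lowFibre m (suc u) = [ suc u ] ⊛ noOneAtMostOneZero m ++ nonZeroExcept u ⊛ vectorsOver nonZero m
  highFibre m zero    = []
  highFibre m (suc u) =
    [ zero ] ⊛ noZeroSomeOne m ++ [ suc u ] ⊛ vectorsOver nonZeroOne m ++ nonZeroExcept u ⊛ vectorsOver nonZero m

  construction : (m : ℕ) → List (Vec F (2 + m))
  construction m =
    [ zero ] ⊛ highHalf ⊛ noZeroSomeOne m ++ consProduct lowHalf (lowFibre m) ++ consProduct highHalf (highFibre m)

  ∈-⊛⁻ : ∀ {m} {xs} {ws : List (Vec F m)} {x w} → x ∷ w ∈ xs ⊛ ws → x ∈ xs × w ∈ ws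
  ∈-⊛⁻ {xs = xs} {ws} = ∈-consProduct⁻ xs (λ _ → ws)

  ∈-[]⊛⁻ : ∀ {m} {y} {ws : List (Vec F m)} {x w} → x ∷ w ∈ [ y ] ⊛ ws → x ≡ y × w ∈ ws
  ∈-[]⊛⁻ x∷w∈ = let x∈ , w∈ = ∈-⊛⁻ x∷w∈ in singleton⁻ x∈ , w∈

  ∈-vectorsOver⁻ : ∀ {L m} {w : Vec F m} → w ∈ vectorsOver L m → ∀ k → lookup w k ∈ L
  ∈-vectorsOver⁻ {L} {suc m} {x ∷ w} x∷w∈ zero    = proj₁ (∈-⊛⁻ {xs = L} x∷w∈)
  ∈-vectorsOver⁻ {L} {suc m} {x ∷ w} x∷w∈ (suc k) = ∈-vectorsOver⁻ (proj₂ (∈-⊛⁻ {xs = L} x∷w∈)) k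

  ∈-vectorsOver-nonZero⁻ : ∀ {m} {w : Vec F m} → w ∈ vectorsOver nonZero m → NoZero w
  ∈-vectorsOver-nonZero⁻ w∈ k = ∈-nonZero⁻ (∈-vectorsOver⁻ w∈ k)

  ∈-vectorsOver-nonZeroOne⁻ : ∀ {m} {w : Vec F m} → w ∈ vectorsOver nonZeroOne m → NoZero w × NoOne w
  ∈-vectorsOver-nonZeroOne⁻ w∈ =
    (λ k → proj₁ (∈-nonZeroOne⁻ (∈-vectorsOver⁻ w∈ k))) , (λ k → proj₂ (∈-nonZeroOne⁻ (∈-vectorsOver⁻ w∈ k)))

  ∈-singleZeroNoOne⁻ : ∀ {m} {w : Vec F m} → w ∈ singleZeroNoOne m → NoOne w × AtMostOneZero w × HasZero w
  ∈-singleZeroNoOne⁻ {suc m} {x ∷ w} x∷w∈ with ∈-++⁻ ([ zero ] ⊛ vectorsOver nonZeroOne m) x∷w∈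
  ... | inj₁ x∷w∈ with ∈-[]⊛⁻ x∷w∈
  ...   | refl , w∈ = noOne , atMostOneZero , (zero , refl)
    where
    noOne : NoOne (zero ∷ w)
    noOne zero    = λ ()
    noOne (suc k) = proj₂ (∈-vectorsOver-nonZeroOne⁻ w∈) k
    atMostOneZero : AtMostOneZero (zero ∷ w)
    atMostOneZero zero    zero     _  _  = refl
    atMostOneZero zero    (suc k') _  w₀ = ⊥-elim (proj₁ (∈-vectorsOver-nonZeroOne⁻ w∈) k' w₀)
    atMostOneZero (suc k) _        w₀ _  = ⊥-elim (proj₁ (∈-vectorsOver-nonZeroOne⁻ w∈) k w₀)
  ∈-singleZeroNoOne⁻ {suc m} {x ∷ w} _ | inj₂ x∷w∈ with ∈-⊛⁻ {xs = nonZeroOne} x∷w∈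
  ...   | x∈ , w∈ with ∈-singleZeroNoOne⁻ w∈
  ...     | noOneʷ , atMostOneZeroʷ , (k₀ , w₀) = noOne , atMostOneZero , (suc k₀ , w₀)
    where
    noOne : NoOne (x ∷ w)
    noOne zero    = proj₂ (∈-nonZeroOne⁻ x∈)
    noOne (suc k) = noOneʷ k
    atMostOneZero : AtMostOneZero (x ∷ w)
    atMostOneZero zero    _        x₀ _  = ⊥-elim (proj₁ (∈-nonZeroOne⁻ x∈) x₀)
    atMostOneZero (suc k) zero     _  x₀ = ⊥-elim (proj₁ (∈-nonZeroOne⁻ x∈) x₀)
    atMostOneZero (suc k) (suc k') w₀ w₀' = cong suc (atMostOneZeroʷ k k' w₀ w₀')

  ∈-noZeroSomeOne⁻ : ∀ {m} {w : Vec F m} → w ∈ noZeroSomeOne m → NoZero w × HasOne w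
  ∈-noZeroSomeOne⁻ {suc m} {x ∷ w} x∷w∈ with ∈-++⁻ ([ one ] ⊛ vectorsOver nonZero m) x∷w∈
  ... | inj₁ x∷w∈ with ∈-[]⊛⁻ x∷w∈
  ...   | refl , w∈ = noZero , (zero , refl)
    where
    noZero : NoZero (one ∷ w)
    noZero zero    = λ ()
    noZero (suc k) = ∈-vectorsOver-nonZero⁻ w∈ k
  ∈-noZeroSomeOne⁻ {suc m} {x ∷ w} _ | inj₂ x∷w∈ with ∈-⊛⁻ {xs = nonZeroOne} x∷w∈
  ...   | x∈ , w∈ with ∈-noZeroSomeOne⁻ w∈
  ...     | noZeroʷ , (k₁ , w₁) = noZero , (suc k₁ , w₁)
    where
    noZero : NoZero (x ∷ w)
    noZero zero    = proj₁ (∈-nonZeroOne⁻ x∈)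
    noZero (suc k) = noZeroʷ k

  ∈-noOneAtMostOneZero⁻ : ∀ {m} {w : Vec F m} → w ∈ noOneAtMostOneZero m → NoOne w × AtMostOneZero w
  ∈-noOneAtMostOneZero⁻ {m} w∈ with ∈-++⁻ (vectorsOver nonZeroOne m) w∈
  ... | inj₁ w∈ = let noZero , noOne = ∈-vectorsOver-nonZeroOne⁻ w∈ in
                  noOne , λ k _ w₀ _ → ⊥-elim (noZero k w₀)
  ... | inj₂ w∈ = let noOne , atMostOneZero , _ = ∈-singleZeroNoOne⁻ w∈ in noOne , atMostOneZero

  lowFibre-admissible : ∀ {m u v} {w : Vec F m} → v ∷ w ∈ lowFibre m u → Low u → Admissible (u ∷ v ∷ w)
  lowFibre-admissible {m} {suc u} v∷w∈ low with ∈-++⁻ ([ suc u ] ⊛ noOneAtMostOneZero m) v∷w∈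
  ... | inj₁ v∷w∈ with ∈-[]⊛⁻ v∷w∈
  ...   | refl , w∈ = let noOne , atMostOneZero = ∈-noOneAtMostOneZero⁻ w∈ in
                      lowDiagonal low noOne atMostOneZero
  lowFibre-admissible {m} {suc u} _ low | inj₂ v∷w∈ with ∈-⊛⁻ {xs = nonZeroExcept u} v∷w∈
  ...   | v∈ , w∈ = let v≢0 , v≢u = ∈-nonZeroExcept⁻ v∈ in
                    offDiagonal (λ ()) v≢0 (v≢u ∘ sym) (∈-vectorsOver-nonZero⁻ w∈)

  highFibre-admissible : ∀ {m u v} {w : Vec F m} → v ∷ w ∈ highFibre m u → High u → Admissible (u ∷ v ∷ w)
  highFibre-admissible {m} {suc u} v∷w∈ high with ∈-++⁻ ([ zero ] ⊛ noZeroSomeOne m) v∷w∈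
  ... | inj₁ v∷w∈ with ∈-[]⊛⁻ v∷w∈
  ...   | refl , w∈ = let noZero , hasOne = ∈-noZeroSomeOne⁻ w∈ in secondAxis high noZero hasOne
  highFibre-admissible {m} {suc u} _ high | inj₂ v∷w∈ with ∈-++⁻ ([ suc u ] ⊛ vectorsOver nonZeroOne m) v∷w∈
  ...   | inj₁ v∷w∈ with ∈-[]⊛⁻ v∷w∈
  ...     | refl , w∈ = let noZero , noOne = ∈-vectorsOver-nonZeroOne⁻ w∈ in highDiagonal high noZero noOne
  highFibre-admissible {m} {suc u} _ high | inj₂ _ | inj₂ v∷w∈ with ∈-⊛⁻ {xs = nonZeroExcept u} v∷w∈
  ...     | v∈ , w∈ = let v≢0 , v≢u = ∈-nonZeroExcept⁻ v∈ in
                      offDiagonal (λ ()) v≢0 (v≢u ∘ sym) (∈-vectorsOver-nonZero⁻ w∈)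

  construction-admissible : ∀ {m} {x : Vec F (2 + m)} → x ∈ construction m → Admissible x
  construction-admissible {m} {u ∷ v ∷ w} x∈ with ∈-++⁻ ([ zero ] ⊛ highHalf ⊛ noZeroSomeOne m) x∈
  ... | inj₁ x∈ with ∈-[]⊛⁻ x∈
  ...   | refl , v∷w∈ with ∈-⊛⁻ {xs = highHalf} v∷w∈
  ...     | v∈ , w∈ = let noZero , hasOne = ∈-noZeroSomeOne⁻ w∈ in firstAxis (∈-highHalf⁻ v∈) noZero hasOne
  construction-admissible {m} {u ∷ v ∷ w} _ | inj₂ x∈ with ∈-++⁻ (consProduct lowHalf (lowFibre m)) x∈
  ...   | inj₁ x∈ = let u∈ , v∷w∈ = ∈-consProduct⁻ lowHalf (lowFibre m) x∈ in
                    lowFibre-admissible v∷w∈ (∈-lowHalf⁻ u∈)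
  ...   | inj₂ x∈ = let u∈ , v∷w∈ = ∈-consProduct⁻ highHalf (highFibre m) x∈ in
                    highFibre-admissible v∷w∈ (∈-highHalf⁻ u∈)

  ⊛⁺ : ∀ {m} {xs} {ws : List (Vec F m)} → Unique xs → Unique ws → Unique (xs ⊛ ws)
  ⊛⁺ xs! ws! = consProduct⁺ xs! (λ _ → ws!)

  ⊛-disjoint : ∀ {m} {xs xs'} {ws ws' : List (Vec F m)} → Disjoint xs xs' → Disjoint (xs ⊛ ws) (xs' ⊛ ws')
  ⊛-disjoint = consProduct-disjoint

  [-]-unique : ∀ {A : Set} {x : A} → Unique [ x ]
  [-]-unique = All.[] ∷ []

  vectorsOver-unique : ∀ {L} m → Unique L → Unique (vectorsOver L m)
  vectorsOver-unique zero    L! = [-]-unique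
  vectorsOver-unique (suc m) L! = ⊛⁺ L! (vectorsOver-unique m L!)

  singleZeroNoOne-unique : ∀ m → Unique (singleZeroNoOne m)
  singleZeroNoOne-unique zero    = []
  singleZeroNoOne-unique (suc m) =
    ++⁺ (⊛⁺ [-]-unique (vectorsOver-unique m nonZeroOne-unique)) (⊛⁺ nonZeroOne-unique (singleZeroNoOne-unique m))
        (⊛-disjoint λ (x∈ , x∈') → proj₁ (∈-nonZeroOne⁻ x∈') (singleton⁻ x∈))

  noZeroSomeOne-unique : ∀ m → Unique (noZeroSomeOne m)
  noZeroSomeOne-unique zero    = []
  noZeroSomeOne-unique (suc m) =
    ++⁺ (⊛⁺ [-]-unique (vectorsOver-unique m nonZero-unique)) (⊛⁺ nonZeroOne-unique (noZeroSomeOne-unique m))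
        (⊛-disjoint λ (x∈ , x∈') → proj₂ (∈-nonZeroOne⁻ x∈') (singleton⁻ x∈))

  noOneAtMostOneZero-unique : ∀ m → Unique (noOneAtMostOneZero m)
  noOneAtMostOneZero-unique m =
    ++⁺ (vectorsOver-unique m nonZeroOne-unique) (singleZeroNoOne-unique m)
        λ (w∈ , w∈') → let k , w₀ = proj₂ (proj₂ (∈-singleZeroNoOne⁻ w∈')) in
                       proj₁ (∈-vectorsOver-nonZeroOne⁻ w∈) k w₀

  lowFibre-unique : ∀ m u → Unique (lowFibre m u)
  lowFibre-unique m zero    = []
  lowFibre-unique m (suc u) =
    ++⁺ (⊛⁺ [-]-unique (noOneAtMostOneZero-unique m)) (⊛⁺ (nonZeroExcept-unique u) (vectorsOver-unique m nonZero-unique))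
        (⊛-disjoint λ (x∈ , x∈') → proj₂ (∈-nonZeroExcept⁻ x∈') (singleton⁻ x∈))

  highFibre-unique : ∀ m u → Unique (highFibre m u)
  highFibre-unique m zero    = []
  highFibre-unique m (suc u) =
    ++⁺ (⊛⁺ [-]-unique (noZeroSomeOne-unique m))
        (++⁺ (⊛⁺ [-]-unique (vectorsOver-unique m nonZeroOne-unique))
             (⊛⁺ (nonZeroExcept-unique u) (vectorsOver-unique m nonZero-unique))
             (⊛-disjoint λ (x∈ , x∈') → proj₂ (∈-nonZeroExcept⁻ x∈') (singleton⁻ x∈)))
        (disjoint-++⁺ʳ {ys = [ suc u ] ⊛ vectorsOver nonZeroOne m}
                       (⊛-disjoint λ (x∈ , x∈') → zero≢suc (trans (sym (singleton⁻ x∈)) (singleton⁻ x∈')))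
                       (⊛-disjoint λ (x∈ , x∈') → proj₁ (∈-nonZeroExcept⁻ {u} x∈') (singleton⁻ x∈)))
    where
    zero≢suc : zero ≢ suc u
    zero≢suc ()

  construction-unique : ∀ m → Unique (construction m)
  construction-unique m =
    ++⁺ (⊛⁺ [-]-unique (⊛⁺ highHalf-unique (noZeroSomeOne-unique m)))
        (++⁺ (consProduct⁺ lowHalf-unique (lowFibre-unique m)) (consProduct⁺ highHalf-unique (highFibre-unique m))
             (consProduct-disjoint {f = lowFibre m} {f' = highFibre m}
                                   λ (x∈ , x∈') → Low⇒¬High (∈-lowHalf⁻ x∈) (∈-highHalf⁻ x∈')))
        (disjoint-++⁺ʳ {ys = consProduct lowHalf (lowFibre m)}
          (consProduct-disjoint {f = λ _ → highHalf ⊛ noZeroSomeOne m} {f' = lowFibre m}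
                                λ (x∈ , x∈') → zero-not-low (singleton⁻ x∈) (∈-lowHalf⁻ x∈'))
          (consProduct-disjoint {f = λ _ → highHalf ⊛ noZeroSomeOne m} {f' = highFibre m}
                                λ (x∈ , x∈') → zero-not-high (singleton⁻ x∈) (∈-highHalf⁻ x∈')))
    where
    zero-not-low : ∀ {x} → x ≡ zero → ¬ Low x
    zero-not-low refl (() , _)
    zero-not-high : ∀ {x} → x ≡ zero → ¬ High x
    zero-not-high refl ()

  -- Counting

  length-⊛ : ∀ {m} xs (ws : List (Vec F m)) → length (xs ⊛ ws) ≡ length xs * length ws
  length-⊛ xs ws = length-consProduct xs (λ _ → ws) (λ _ → refl)

  length-[]⊛ : ∀ {m} x (ws : List (Vec F m)) → length ([ x ] ⊛ ws) ≡ length ws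
  length-[]⊛ x ws = trans (length-⊛ [ x ] ws) (+-identityʳ (length ws))

  length-nonZero : length nonZero ≡ h + h
  length-nonZero = length-tabulate suc

  length-nonZeroOne : length nonZeroOne ≡ s
  length-nonZeroOne = length-tabulate (λ (i : Fin s) → suc (suc i))

  length-lowHalf : length lowHalf ≡ h
  length-lowHalf = length-tabulate (λ (i : Fin h) → suc (i ↑ˡ h))

  length-highHalf : length highHalf ≡ h
  length-highHalf = length-tabulate (λ (i : Fin h) → suc (h ↑ʳ i))

  length-nonZeroExcept : ∀ u → length (nonZeroExcept u) ≡ s
  length-nonZeroExcept u = length-tabulate (λ (j : Fin s) → suc (punchIn u j))

  length-vectorsOver : ∀ {L c} m → length L ≡ c → length (vectorsOver L m) ≡ c ^ m
  length-vectorsOver         zero    _  = refl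
  length-vectorsOver {L} {c} (suc m) eq =
    trans (length-⊛ L (vectorsOver L m)) (cong₂ _*_ eq (length-vectorsOver m eq))

  length-nonZeroExcept⊛nonZero : ∀ m u → length (nonZeroExcept u ⊛ vectorsOver nonZero m) ≡ s * (h + h) ^ m
  length-nonZeroExcept⊛nonZero m u =
    trans (length-⊛ (nonZeroExcept u) (vectorsOver nonZero m))
          (cong₂ _*_ (length-nonZeroExcept u) (length-vectorsOver m length-nonZero))

  length-singleZeroNoOne-suc : ∀ m → length (singleZeroNoOne (suc m)) ≡ s ^ m + s * length (singleZeroNoOne m)
  length-singleZeroNoOne-suc m = begin
    length ([ zero ] ⊛ vectorsOver nonZeroOne m ++ nonZeroOne ⊛ singleZeroNoOne m)
      ≡⟨ length-++ ([ zero ] ⊛ vectorsOver nonZeroOne m) ⟩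
    length ([ zero ] ⊛ vectorsOver nonZeroOne m) + length (nonZeroOne ⊛ singleZeroNoOne m)
      ≡⟨ cong₂ _+_ (trans (length-[]⊛ zero (vectorsOver nonZeroOne m)) (length-vectorsOver m length-nonZeroOne))
                   (trans (length-⊛ nonZeroOne (singleZeroNoOne m)) (cong (_* length (singleZeroNoOne m)) length-nonZeroOne)) ⟩
    s ^ m + s * length (singleZeroNoOne m) ∎
    where open ≡-Reasoning

  length-singleZeroNoOne : ∀ k → length (singleZeroNoOne (suc k)) ≡ suc k * s ^ k
  length-singleZeroNoOne zero    = trans (length-singleZeroNoOne-suc zero) (cong suc (*-zeroʳ s))
  length-singleZeroNoOne (suc k) = begin
    length (singleZeroNoOne (2 + k))              ≡⟨ length-singleZeroNoOne-suc (suc k) ⟩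
    s ^ suc k + s * length (singleZeroNoOne (suc k)) ≡⟨ cong (λ l → s ^ suc k + s * l) (length-singleZeroNoOne k) ⟩
    s * s ^ k + s * (suc k * s ^ k)          ≡⟨ regroup s (s ^ k) k ⟩
    suc (suc k) * (s * s ^ k)                ∎
    where
    open ≡-Reasoning
    regroup : ∀ a b k → a * b + a * (suc k * b) ≡ suc (suc k) * (a * b)
    regroup = solve-∀

  length-noZeroSomeOne : ∀ m → length (noZeroSomeOne m) + s ^ m ≡ (h + h) ^ m
  length-noZeroSomeOne zero    = refl
  length-noZeroSomeOne (suc m) = begin
    length ([ one ] ⊛ vectorsOver nonZero m ++ nonZeroOne ⊛ noZeroSomeOne m) + s ^ suc m
      ≡⟨ cong (_+ s ^ suc m) (length-++ ([ one ] ⊛ vectorsOver nonZero m)) ⟩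
    (length ([ one ] ⊛ vectorsOver nonZero m) + length (nonZeroOne ⊛ noZeroSomeOne m)) + s ^ suc m
      ≡⟨ cong (_+ s ^ suc m) (cong₂ _+_ (trans (length-[]⊛ one (vectorsOver nonZero m)) (length-vectorsOver m length-nonZero))
                                          (trans (length-⊛ nonZeroOne (noZeroSomeOne m)) (cong (_* length (noZeroSomeOne m)) length-nonZeroOne))) ⟩
    ((h + h) ^ m + s * length (noZeroSomeOne m)) + s * s ^ m
      ≡⟨ regroup ((h + h) ^ m) s (length (noZeroSomeOne m)) (s ^ m) ⟩
    (h + h) ^ m + s * (length (noZeroSomeOne m) + s ^ m)
      ≡⟨ cong (λ l → (h + h) ^ m + s * l) (length-noZeroSomeOne m) ⟩
    (h + h) ^ m + s * (h + h) ^ m ∎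
    where
    open ≡-Reasoning
    regroup : ∀ a b c d → (a + b * c) + b * d ≡ a + b * (c + d)
    regroup = solve-∀

  length-lowFibre : ∀ m {u} → u ≢ zero →
    length (lowFibre m u) ≡ (s ^ m + length (singleZeroNoOne m)) + s * (h + h) ^ m
  length-lowFibre m {zero}  u≢0 = ⊥-elim (u≢0 refl)
  length-lowFibre m {suc u} _   = begin
    length ([ suc u ] ⊛ noOneAtMostOneZero m ++ nonZeroExcept u ⊛ vectorsOver nonZero m)
      ≡⟨ length-++ ([ suc u ] ⊛ noOneAtMostOneZero m) ⟩
    length ([ suc u ] ⊛ noOneAtMostOneZero m) + length (nonZeroExcept u ⊛ vectorsOver nonZero m)
      ≡⟨ cong₂ _+_ (trans (length-[]⊛ (suc u) (noOneAtMostOneZero m)) (length-++ (vectorsOver nonZeroOne m)))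
                   (length-nonZeroExcept⊛nonZero m u) ⟩
    (length (vectorsOver nonZeroOne m) + length (singleZeroNoOne m)) + s * (h + h) ^ m
      ≡⟨ cong (λ l → (l + length (singleZeroNoOne m)) + s * (h + h) ^ m) (length-vectorsOver m length-nonZeroOne) ⟩
    (s ^ m + length (singleZeroNoOne m)) + s * (h + h) ^ m ∎
    where open ≡-Reasoning

  length-highFibre : ∀ m {u} → u ≢ zero →
    length (highFibre m u) ≡ length (noZeroSomeOne m) + (s ^ m + s * (h + h) ^ m)
  length-highFibre m {zero}  u≢0 = ⊥-elim (u≢0 refl)
  length-highFibre m {suc u} _   = begin
    length ([ zero ] ⊛ noZeroSomeOne m ++ [ suc u ] ⊛ vectorsOver nonZeroOne m ++ nonZeroExcept u ⊛ vectorsOver nonZero m)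
      ≡⟨ length-++ ([ zero ] ⊛ noZeroSomeOne m) ⟩
    length ([ zero ] ⊛ noZeroSomeOne m) + length ([ suc u ] ⊛ vectorsOver nonZeroOne m ++ nonZeroExcept u ⊛ vectorsOver nonZero m)
      ≡⟨ cong₂ _+_ (length-[]⊛ zero (noZeroSomeOne m)) (length-++ ([ suc u ] ⊛ vectorsOver nonZeroOne m)) ⟩
    length (noZeroSomeOne m) + (length ([ suc u ] ⊛ vectorsOver nonZeroOne m) + length (nonZeroExcept u ⊛ vectorsOver nonZero m))
      ≡⟨ cong (length (noZeroSomeOne m) +_) (cong₂ _+_
           (trans (length-[]⊛ (suc u) (vectorsOver nonZeroOne m)) (length-vectorsOver m length-nonZeroOne))
           (length-nonZeroExcept⊛nonZero m u)) ⟩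
    length (noZeroSomeOne m) + (s ^ m + s * (h + h) ^ m) ∎
    where open ≡-Reasoning

  length-construction : ∀ m → length (construction m) ≡
    h * length (noZeroSomeOne m) +
    (h * ((s ^ m + length (singleZeroNoOne m)) + s * (h + h) ^ m) + h * (length (noZeroSomeOne m) + (s ^ m + s * (h + h) ^ m)))
  length-construction m = begin
    length ([ zero ] ⊛ highHalf ⊛ noZeroSomeOne m ++ consProduct lowHalf (lowFibre m) ++ consProduct highHalf (highFibre m))
      ≡⟨ length-++ ([ zero ] ⊛ highHalf ⊛ noZeroSomeOne m) ⟩
    length ([ zero ] ⊛ highHalf ⊛ noZeroSomeOne m) + length (consProduct lowHalf (lowFibre m) ++ consProduct highHalf (highFibre m))
      ≡⟨ cong₂ _+_ (trans (length-[]⊛ zero (highHalf ⊛ noZeroSomeOne m))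
                          (trans (length-⊛ highHalf (noZeroSomeOne m)) (cong (_* length (noZeroSomeOne m)) length-highHalf)))
                   (length-++ (consProduct lowHalf (lowFibre m))) ⟩
    h * length (noZeroSomeOne m) + (length (consProduct lowHalf (lowFibre m)) + length (consProduct highHalf (highFibre m)))
      ≡⟨ cong (h * length (noZeroSomeOne m) +_) (cong₂ _+_
           (trans (length-consProduct lowHalf (lowFibre m) (λ u∈ → length-lowFibre m (Low⇒≢zero (∈-lowHalf⁻ u∈))))
                  (cong (_* ((s ^ m + length (singleZeroNoOne m)) + s * (h + h) ^ m)) length-lowHalf))
           (trans (length-consProduct highHalf (highFibre m) (λ u∈ → length-highFibre m (High⇒≢zero (∈-highHalf⁻ u∈))))
                  (cong (_* (length (noZeroSomeOne m) + (s ^ m + s * (h + h) ^ m))) length-highHalf))) ⟩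
    h * length (noZeroSomeOne m) +
    (h * ((s ^ m + length (singleZeroNoOne m)) + s * (h + h) ^ m) + h * (length (noZeroSomeOne m) + (s ^ m + s * (h + h) ^ m))) ∎
    where open ≡-Reasoning

  -- (2h)ᵏ⁺¹ is replaced by |noZeroSomeOne (k + 1)| + s·sᵏ, which leaves a polynomial identity.
  length-construction-bound : ∀ k →
    2 * (h + h) ^ (3 + k) + suc k * (h + h) * s ^ k ≡ 2 * length (construction (suc k))
  length-construction-bound k = begin
    2 * ((h + h) * ((h + h) * (h + h) ^ suc k)) + suc k * (h + h) * Y
      ≡⟨ cong (λ q → 2 * ((h + h) * ((h + h) * q)) + suc k * (h + h) * Y) (length-noZeroSomeOne (suc k)) ⟨
    2 * ((h + h) * ((h + h) * (W + s * Y))) + suc k * (h + h) * Y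
      ≡⟨ regroup g k W Y ⟩
    2 * (h * W + (h * ((s * Y + suc k * Y) + s * (W + s * Y)) + h * (W + (s * Y + s * (W + s * Y)))))
      ≡⟨ cong₂ (λ z q → 2 * (h * W + (h * ((s * Y + z) + s * q) + h * (W + (s * Y + s * q)))))
               (sym (length-singleZeroNoOne k)) (length-noZeroSomeOne (suc k)) ⟩
    2 * (h * W + (h * ((s ^ suc k + length (singleZeroNoOne (suc k))) + s * (h + h) ^ suc k)
                  + h * (W + (s ^ suc k + s * (h + h) ^ suc k))))
      ≡⟨ cong (2 *_) (length-construction (suc k)) ⟨
    2 * length (construction (suc k)) ∎
    where
    open ≡-Reasoning
    W Y : ℕ
    W = length (noZeroSomeOne (suc k))
    Y = s ^ k
    regroup : ∀ g k W Y →
      2 * ((suc g + suc g) * ((suc g + suc g) * (W + (g + suc g) * Y))) + suc k * (suc g + suc g) * Y ≡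
      2 * (suc g * W + (suc g * (((g + suc g) * Y + suc k * Y) + (g + suc g) * (W + (g + suc g) * Y))
                       + suc g * (W + ((g + suc g) * Y + (g + suc g) * (W + (g + suc g) * Y)))))
    regroup = solve-∀

  -- No line lies in the construction

  High-+ₚ-≢zero : ∀ {x y} → High x → High y → x +ₚ y ≢ zero
  High-+ₚ-≢zero {x} {y} h<x h<y x+y≡0 = <⇒≱ P<X+Y (m∸n≡0⇒m≤n (begin
    X + Y ∸ P              ≡⟨ m<n⇒m%n≡m (m<n+o⇒m∸n<o (X + Y) P X+Y<P+P) ⟨
    (X + Y ∸ P) % P        ≡⟨ m≤n⇒[n∸m]%m≡n%m (<⇒≤ P<X+Y) ⟩
    (X + Y) % P            ≡⟨ toℕ-mod (X + Y) ⟨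
    toℕ (x +ₚ y)           ≡⟨ cong toℕ x+y≡0 ⟩
    0                      ∎))
    where
    open ≡-Reasoning
    X Y : ℕ
    X = toℕ x
    Y = toℕ y
    P<X+Y : P < X + Y
    P<X+Y = subst (_≤ X + Y) (cong suc (+-suc h h)) (+-mono-≤ h<x h<y)
    X+Y<P+P : X + Y < P + P
    X+Y<P+P = <-trans (+-monoˡ-< Y (toℕ<n x)) (+-monoʳ-< P (toℕ<n y))

  Admissible-swap : ∀ {m u v} {w : Vec F m} → Admissible (u ∷ v ∷ w) → Admissible (v ∷ u ∷ w)
  Admissible-swap (offDiagonal u≢0 v≢0 u≢v noZero)      = offDiagonal v≢0 u≢0 (u≢v ∘ sym) noZero
  Admissible-swap (lowDiagonal low noOne atMostOneZero) = lowDiagonal low noOne atMostOneZero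
  Admissible-swap (highDiagonal high noZero noOne)      = highDiagonal high noZero noOne
  Admissible-swap (firstAxis high noZero hasOne)        = secondAxis high noZero hasOne
  Admissible-swap (secondAxis high noZero hasOne)       = firstAxis high noZero hasOne

  zeroInTail⇒lowDiagonal : ∀ {m u v} {w : Vec F m} {k} → Admissible (u ∷ v ∷ w) → lookup w k ≡ zero →
                           u ≡ v × Low u × NoOne w × AtMostOneZero w
  zeroInTail⇒lowDiagonal {k = k} (offDiagonal _ _ _ noZero) w₀ = ⊥-elim (noZero k w₀)
  zeroInTail⇒lowDiagonal (lowDiagonal low noOne atMostOneZero) _ = refl , low , noOne , atMostOneZero
  zeroInTail⇒lowDiagonal {k = k} (highDiagonal _ noZero _) w₀ = ⊥-elim (noZero k w₀)
  zeroInTail⇒lowDiagonal {k = k} (firstAxis _ noZero _) w₀    = ⊥-elim (noZero k w₀)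
  zeroInTail⇒lowDiagonal {k = k} (secondAxis _ noZero _) w₀   = ⊥-elim (noZero k w₀)

  firstZero⇒ : ∀ {m u v} {w : Vec F m} → Admissible (u ∷ v ∷ w) → u ≡ zero → High v × HasOne w
  firstZero⇒ (offDiagonal u≢0 _ _ _) u≡0    = ⊥-elim (u≢0 u≡0)
  firstZero⇒ (lowDiagonal low _ _) u≡0      = ⊥-elim (Low⇒≢zero low u≡0)
  firstZero⇒ (highDiagonal high _ _) u≡0    = ⊥-elim (High⇒≢zero high u≡0)
  firstZero⇒ (firstAxis high _ hasOne) _    = high , hasOne
  firstZero⇒ (secondAxis high _ _) u≡0      = ⊥-elim (High⇒≢zero high u≡0)

  secondZero⇒ : ∀ {m u v} {w : Vec F m} → Admissible (u ∷ v ∷ w) → v ≡ zero → High u × HasOne w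
  secondZero⇒ admissible = firstZero⇒ (Admissible-swap admissible)

  diagonal⇒NoOne : ∀ {m u v} {w : Vec F m} → Admissible (u ∷ v ∷ w) → u ≡ v → NoOne w
  diagonal⇒NoOne (offDiagonal _ _ u≢v _) u≡v = ⊥-elim (u≢v u≡v)
  diagonal⇒NoOne (lowDiagonal _ noOne _) _   = noOne
  diagonal⇒NoOne (highDiagonal _ _ noOne) _  = noOne
  diagonal⇒NoOne (firstAxis high _ _) 0≡v    = ⊥-elim (High⇒≢zero high (sym 0≡v))
  diagonal⇒NoOne (secondAxis high _ _) u≡0   = ⊥-elim (High⇒≢zero high u≡0)

  module AdmissibleLine (P-prime : Prime P) {m} (aw bw : Vec F m) (a₁ b₁ a₂ b₂ : F)
    (admissible : ∀ i → Admissible (line a₁ b₁ i ∷ line a₂ b₂ i ∷ linePt aw bw i)) where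

    open TwoLines a₁ b₁ a₂ b₂

    U V : F → F
    U = line a₁ b₁
    V = line a₂ b₂

    W : F → Vec F m
    W = linePt aw bw

    U-hits-zero : b₁ ≢ zero → ∃ λ t → U t ≡ zero
    U-hits-zero b₁≢0 = line-surjective P-prime a₁ b₁≢0 zero

    V-hits-zero : b₂ ≢ zero → ∃ λ t → V t ≡ zero
    V-hits-zero b₂≢0 = line-surjective P-prime a₂ b₂≢0 zero

    module NonconstantTail (k : Fin m) (bₖ≢0 : lookup bw k ≢ zero) where

      tail-hits : ∀ y → ∃ λ i → lookup (W i) k ≡ y
      tail-hits y with line-surjective P-prime (lookup aw k) bₖ≢0 y
      ... | i , eq = i , trans (lookup-linePt aw bw i k) eq

      i₀ i₁ : F
      i₀ = proj₁ (tail-hits zero)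
      i₁ = proj₁ (tail-hits one)

      W₀ : lookup (W i₀) k ≡ zero
      W₀ = proj₂ (tail-hits zero)

      W₁ : lookup (W i₁) k ≡ one
      W₁ = proj₂ (tail-hits one)

      meet₀ : Meet i₀
      meet₀ = proj₁ (zeroInTail⇒lowDiagonal (admissible i₀) W₀)

      low₀ : Low (U i₀)
      low₀ = proj₁ (proj₂ (zeroInTail⇒lowDiagonal (admissible i₀) W₀))

      noOne₀ : NoOne (W i₀)
      noOne₀ = proj₁ (proj₂ (proj₂ (zeroInTail⇒lowDiagonal (admissible i₀) W₀)))

      atMostOneZero₀ : AtMostOneZero (W i₀)
      atMostOneZero₀ = proj₂ (proj₂ (proj₂ (zeroInTail⇒lowDiagonal (admissible i₀) W₀)))

      parallel⇒⊥ : b₁ ≡ b₂ → ⊥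
      parallel⇒⊥ b₁≡b₂ =
        diagonal⇒NoOne (admissible i₁) (parallel-meet⇒meet-everywhere b₁≡b₂ {i₀} meet₀ i₁) k W₁

      second-constant⇒⊥ : b₁ ≢ zero → b₂ ≡ zero → ⊥
      second-constant⇒⊥ b₁≢0 b₂≡0 with U-hits-zero b₁≢0
      ... | t , Ut≡0 = Low⇒¬High (subst Low Ui₀≡Vt low₀) (proj₁ (firstZero⇒ (admissible t) Ut≡0))
        where
        Ui₀≡Vt : U i₀ ≡ V t
        Ui₀≡Vt = trans meet₀ (trans (line-constant a₂ b₂≡0 i₀) (sym (line-constant a₂ b₂≡0 t)))

      module Crossing (b₁≢b₂ : b₁ ≢ b₂) where

        other-tail-constant : ∀ k' → k' ≢ k → lookup bw k' ≡ zero
        other-tail-constant k' k'≢k with lookup bw k' ≟ᶠ zero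
        ... | yes bₖ'≡0 = bₖ'≡0
        ... | no bₖ'≢0 with line-surjective P-prime (lookup aw k') bₖ'≢0 zero
        ...   | t , Wₖ't≡0 = ⊥-elim (k'≢k (atMostOneZero₀ k' k (subst (λ i → lookup (W i) k' ≡ zero) t≡i₀ Wt≡0) W₀))
          where
          Wt≡0 : lookup (W t) k' ≡ zero
          Wt≡0 = trans (lookup-linePt aw bw t k') Wₖ't≡0
          t≡i₀ : t ≡ i₀
          t≡i₀ = crossing-meet-unique P-prime b₁≢b₂ {t} {i₀} (proj₁ (zeroInTail⇒lowDiagonal (admissible t) Wt≡0)) meet₀

        hasOne⇒≡i₁ : ∀ t → HasOne (W t) → t ≡ i₁
        hasOne⇒≡i₁ t (k₁ , Wt≡1) with k₁ ≟ᶠ k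
        ... | yes refl = line-injective P-prime (lookup aw k) bₖ≢0
                           (trans (sym (lookup-linePt aw bw t k)) (trans Wt≡1 (trans (sym W₁) (lookup-linePt aw bw i₁ k))))
        ... | no k₁≢k = ⊥-elim (noOne₀ k₁ (begin
          lookup (W i₀) k₁                               ≡⟨ lookup-linePt aw bw i₀ k₁ ⟩
          line (lookup aw k₁) (lookup bw k₁) i₀          ≡⟨ line-constant (lookup aw k₁) (other-tail-constant k₁ k₁≢k) i₀ ⟩
          lookup aw k₁                                   ≡⟨ line-constant (lookup aw k₁) (other-tail-constant k₁ k₁≢k) t ⟨
          line (lookup aw k₁) (lookup bw k₁) t           ≡⟨ lookup-linePt aw bw t k₁ ⟨
          lookup (W t) k₁                                ≡⟨ Wt≡1 ⟩
          one                                            ∎))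
          where open ≡-Reasoning

        both-moving⇒⊥ : b₁ ≢ zero → b₂ ≢ zero → ⊥
        both-moving⇒⊥ b₁≢0 b₂≢0 with U-hits-zero b₁≢0 | V-hits-zero b₂≢0
        ... | t₁ , Ut₁≡0 | t₂ , Vt₂≡0 = High⇒≢zero (proj₁ (firstZero⇒ (admissible t₁) Ut₁≡0)) (trans (cong V t₁≡t₂) Vt₂≡0)
          where
          t₁≡t₂ : t₁ ≡ t₂
          t₁≡t₂ = trans (hasOne⇒≡i₁ t₁ (proj₂ (firstZero⇒ (admissible t₁) Ut₁≡0)))
                        (sym (hasOne⇒≡i₁ t₂ (proj₂ (secondZero⇒ (admissible t₂) Vt₂≡0))))

    module ConstantTail (tail≡0 : ∀ k → lookup bw k ≡ zero) (b₁≢0 : b₁ ≢ zero) where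

      t₁ : F
      t₁ = proj₁ (U-hits-zero b₁≢0)

      Ut₁≡0 : U t₁ ≡ zero
      Ut₁≡0 = proj₂ (U-hits-zero b₁≢0)

      highVt₁ : High (V t₁)
      highVt₁ = proj₁ (firstZero⇒ (admissible t₁) Ut₁≡0)

      k₁ : Fin m
      k₁ = proj₁ (proj₂ (firstZero⇒ (admissible t₁) Ut₁≡0))

      W-constant : ∀ i → lookup (W i) k₁ ≡ lookup aw k₁
      W-constant i = trans (lookup-linePt aw bw i k₁) (line-constant (lookup aw k₁) (tail≡0 k₁) i)

      one-everywhere : ∀ i → lookup (W i) k₁ ≡ one
      one-everywhere i =
        trans (W-constant i) (trans (sym (W-constant t₁)) (proj₂ (proj₂ (firstZero⇒ (admissible t₁) Ut₁≡0))))

      crossing⇒⊥ : b₁ ≢ b₂ → ⊥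
      crossing⇒⊥ b₁≢b₂ =
        let i , meet = crossing-meet P-prime b₁≢b₂ in diagonal⇒NoOne (admissible i) meet k₁ (one-everywhere i)

      parallel⇒⊥ : b₁ ≡ b₂ → ⊥
      parallel⇒⊥ b₁≡b₂ with V-hits-zero (b₁≢0 ∘ trans b₁≡b₂)
      ... | t₂ , Vt₂≡0 = High-+ₚ-≢zero highVt₁ (proj₁ (secondZero⇒ (admissible t₂) Vt₂≡0))
                                       (parallel-zeros b₁≡b₂ {t₁} {t₂} Ut₁≡0 Vt₂≡0)

  module _ (P-prime : Prime P) {m} (aw bw : Vec F m) (a₁ b₁ a₂ b₂ : F)
    (admissible : ∀ i → Admissible (line a₁ b₁ i ∷ line a₂ b₂ i ∷ linePt aw bw i)) where

    private
      module Line    = AdmissibleLine P-prime aw bw a₁ b₁ a₂ b₂ admissible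
      module Swapped = AdmissibleLine P-prime aw bw a₂ b₂ a₁ b₁ (Admissible-swap ∘ admissible)

    nonconstant-tail⇒⊥ : ∀ k → lookup bw k ≢ zero → ⊥
    nonconstant-tail⇒⊥ k bₖ≢0 with b₁ ≟ᶠ b₂ | b₁ ≟ᶠ zero | b₂ ≟ᶠ zero
    ... | yes b₁≡b₂ | _        | _        = Line.NonconstantTail.parallel⇒⊥ k bₖ≢0 b₁≡b₂
    ... | no b₁≢b₂  | no b₁≢0  | no b₂≢0  =
      Line.NonconstantTail.Crossing.both-moving⇒⊥ k bₖ≢0 b₁≢b₂ b₁≢0 b₂≢0
    ... | no _      | no b₁≢0  | yes b₂≡0 = Line.NonconstantTail.second-constant⇒⊥ k bₖ≢0 b₁≢0 b₂≡0
    ... | no _      | yes b₁≡0 | no b₂≢0  = Swapped.NonconstantTail.second-constant⇒⊥ k bₖ≢0 b₂≢0 b₁≡0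
    ... | no b₁≢b₂  | yes b₁≡0 | yes b₂≡0 = b₁≢b₂ (trans b₁≡0 (sym b₂≡0))

    constant-tail⇒⊥ : (∀ k → lookup bw k ≡ zero) → b₁ ≢ zero ⊎ b₂ ≢ zero → ⊥
    constant-tail⇒⊥ tail≡0 (inj₁ b₁≢0) with b₁ ≟ᶠ b₂
    ... | yes b₁≡b₂ = Line.ConstantTail.parallel⇒⊥ tail≡0 b₁≢0 b₁≡b₂
    ... | no b₁≢b₂  = Line.ConstantTail.crossing⇒⊥ tail≡0 b₁≢0 b₁≢b₂
    constant-tail⇒⊥ tail≡0 (inj₂ b₂≢0) with b₂ ≟ᶠ b₁
    ... | yes b₂≡b₁ = Swapped.ConstantTail.parallel⇒⊥ tail≡0 b₂≢0 b₂≡b₁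
    ... | no b₂≢b₁  = Swapped.ConstantTail.crossing⇒⊥ tail≡0 b₂≢0 b₂≢b₁

  no-admissible-line : Prime P → ∀ {m} (a b : Vec F (2 + m)) → NonZeroVec b → ¬ (∀ i → Admissible (linePt a b i))
  no-admissible-line P-prime (a₁ ∷ a₂ ∷ aw) (b₁ ∷ b₂ ∷ bw) (j , bⱼ≢0) admissible
    with any? (λ k → ¬? (lookup bw k ≟ᶠ zero))
  ... | yes (k , bₖ≢0) = nonconstant-tail⇒⊥ P-prime aw bw a₁ b₁ a₂ b₂ admissible k bₖ≢0
  ... | no ∄bₖ≢0 = constant-tail⇒⊥ P-prime aw bw a₁ b₁ a₂ b₂ admissible tail≡0 (moving j bⱼ≢0)
    where
    tail≡0 : ∀ k → lookup bw k ≡ zero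
    tail≡0 k = decidable-stable (lookup bw k ≟ᶠ zero) (λ bₖ≢0 → ∄bₖ≢0 (k , bₖ≢0))
    moving : ∀ j → toℕ (lookup (b₁ ∷ b₂ ∷ bw) j) ≢ 0 → b₁ ≢ zero ⊎ b₂ ≢ zero
    moving zero          b₁≢0 = inj₁ (b₁≢0 ∘ cong toℕ)
    moving (suc zero)    b₂≢0 = inj₂ (b₂≢0 ∘ cong toℕ)
    moving (suc (suc k)) bₖ≢0 = ⊥-elim (bₖ≢0 (cong toℕ (tail≡0 k)))

  construction-progressionFree : Prime P → ∀ m → ProgressionFree (construction m)
  construction-progressionFree P-prime m a b b≢0 line⊆construction =
    no-admissible-line P-prime a b b≢0 (λ i → construction-admissible (line⊆construction i))

odd-prime-shape : ∀ {p} → Prime p → 3 ≤ p → ∃ λ g → p ≡ suc (suc g + suc g)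
odd-prime-shape {suc (suc (suc q))} p-prime (s≤s (s≤s (s≤s _))) with q % 2 | m≡m%n+[m/n]*n q 2 | m%n<n q 2
... | zero          | q≡ | _ = q / 2 , cong (2 +_) (trans (cong suc q≡) (double+1 (q / 2)))
  where
  double+1 : ∀ g → suc (g * 2) ≡ g + suc g
  double+1 = solve-∀
... | suc zero      | q≡ | _ = ⊥-elim (prime⇒¬composite p-prime (composite-≢ 2 (λ ()) 2∣p))
  where
  2∣p : 2 ∣ 3 + q
  2∣p = divides (q / 2 + 2) (trans (cong (3 +_) q≡) (double+4 (q / 2)))
    where
    double+4 : ∀ g → 3 + (1 + g * 2) ≡ (g + 2) * 2
    double+4 = solve-∀
... | suc (suc _)   | _  | s≤s (s≤s ())

theorem1p7 : (p n : ℕ) → Prime p → 3 ≤ p → 3 ≤ n →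
    Σ[ A ∈ List (Vec (Fin p) n) ]
      (Unique A × ProgressionFree A ×
       (2 * (p ∸ 1) ^ n + (n ∸ 2) * (p ∸ 1) * (p ∸ 2) ^ (n ∸ 3) ≤ 2 * length A))
theorem1p7 p (suc (suc (suc k))) p-prime 3≤p (s≤s (s≤s (s≤s _))) with odd-prime-shape p-prime 3≤p
... | g , refl = construction (suc k)
               , construction-unique (suc k)
               , construction-progressionFree p-prime (suc k)
               , ≤-reflexive (length-construction-bound k)
  where open Construction g
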